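{- Let $G$ be a connected finite simple graph on $n\ge 1$ vertices. Then $noc(G)\le 2^{n-1}+n$. Moreover, equality holds if and only if $G$ is isomorphic to the star $K_{1,n-1}$, the path $P_4$, or the path $P_5$.
   Context: For a finite simple undirected graph $G=(V,E)$, a set $S\subseteq V$ is called $P_3$-convex if for every path $x$--$z$--$y$ in $G$ (distinct vertices $x,z,y$ with $xz,zy\in E$) with $x,y\in S$, we also have $z\in S$. The number $noc(G)$ denotes the number of $P_3$-convex subsets of $V$ (including $\emptyset$). $K_{1,n-1}$ is the star on $n$ vertices and $P_k$ the path on $k$ vertices. -}

module Defs where

open import Data.Nat using (ℕ; zero; suc; _+_; _∸_; _^_; _≤_)
open import Data.Fin using (Fin; toℕ)
open import Data.Fin.Properties using (all?; _≟_)
open import Data.Bool using (Bool; true; false; T)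
open import Data.Bool.Properties using (T?)
open import Data.Vec using (Vec; []; _∷_; lookup)
open import Data.List using (List; []; _∷_; _++_; map; length; filter)
open import Data.Product using (_×_; _,_)
open import Data.Sum using (_⊎_)
open import Relation.Nullary using (¬_; Dec)
open import Relation.Nullary.Decidable using (_→-dec_; ¬?)
open import Relation.Binary.PropositionalEquality using (_≡_; _≢_)
open import Function.Bundles using (_↔_; Inverse)

record Graph (n : ℕ) : Set₁ where
  field
    Adj     : Fin n → Fin n → Set
    adj?    : ∀ x y → Dec (Adj x y)
    symAdj  : ∀ {x y} → Adj x y → Adj y x
    irrefl  : ∀ {x} → ¬ Adj x x
open Graph public

data Reach {n : ℕ} (G : Graph n) : Fin n → Fin n → Set where
  here  : ∀ {u} → Reach G u u
  step  : ∀ {u w v} → Adj G u w → Reach G w v → Reach G u v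

Connected : ∀ {n} → Graph n → Set
Connected {n} G = ∀ (u v : Fin n) → Reach G u v

VSet : ℕ → Set
VSet n = Vec Bool n

_∈ₛ_ : ∀ {n} → Fin n → VSet n → Set
x ∈ₛ S = T (lookup S x)

P3Convex : ∀ {n} → Graph n → VSet n → Set
P3Convex {n} G S = ∀ (x z y : Fin n) →
  x ≢ z → z ≢ y → x ≢ y → Adj G x z → Adj G z y → x ∈ₛ S → y ∈ₛ S → z ∈ₛ S

P3Convex? : ∀ {n} (G : Graph n) (S : VSet n) → Dec (P3Convex G S)
P3Convex? G S = all? λ x → all? λ z → all? λ y →
  ¬? (x ≟ z) →-dec ¬? (z ≟ y) →-dec ¬? (x ≟ y) →-dec adj? G x z →-dec adj? G z y
  →-dec T? (lookup S x) →-dec T? (lookup S y) →-dec T? (lookup S z)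

allVSets : (n : ℕ) → List (VSet n)
allVSets zero = [] ∷ []
allVSets (suc n) = map (true ∷_) (allVSets n) ++ map (false ∷_) (allVSets n)

noc : ∀ {n} → Graph n → ℕ
noc {n} G = length (filter (P3Convex? G) (allVSets n))

record _≅_ {n m : ℕ} (G : Graph n) (H : Graph m) : Set where
  field
    bij      : Fin n ↔ Fin m
    preserve : ∀ x y → Adj G x y → Adj H (Inverse.to bij x) (Inverse.to bij y)
    reflect  : ∀ x y → Adj H (Inverse.to bij x) (Inverse.to bij y) → Adj G x y

StarAdj : ∀ {n} → Fin n → Fin n → Set
StarAdj x y = (toℕ x ≡ 0 × toℕ y ≢ 0) ⊎ (toℕ x ≢ 0 × toℕ y ≡ 0)

PathAdj : ∀ {n} → Fin n → Fin n → Set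
PathAdj x y = (suc (toℕ x) ≡ toℕ y) ⊎ (suc (toℕ y) ≡ toℕ x)

private
  open import Data.Nat.Properties as ℕP using ()
  open import Data.Sum using (inj₁; inj₂)
  open import Relation.Nullary.Decidable using (_⊎-dec_; _×-dec_)
  open import Relation.Binary.PropositionalEquality using (refl; sym)
  open import Data.Empty using (⊥)

  n≢1+n : ∀ k → suc k ≢ k
  n≢1+n zero ()
  n≢1+n (suc k) p = n≢1+n k (ℕP.suc-injective p)

star : (n : ℕ) → Graph n
star n = record
  { Adj    = StarAdj
  ; adj?   = λ x y → ((toℕ x ℕP.≟ 0) ×-dec ¬? (toℕ y ℕP.≟ 0))
                     ⊎-dec (¬? (toℕ x ℕP.≟ 0) ×-dec (toℕ y ℕP.≟ 0))
  ; symAdj = λ { (inj₁ (a , b)) → inj₂ (b , a) ; (inj₂ (a , b)) → inj₁ (b , a) }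
  ; irrefl = λ { (inj₁ (a , b)) → b a ; (inj₂ (a , b)) → a b }
  }

path : (n : ℕ) → Graph n
path n = record
  { Adj    = PathAdj
  ; adj?   = λ x y → (suc (toℕ x) ℕP.≟ toℕ y) ⊎-dec (suc (toℕ y) ℕP.≟ toℕ x)
  ; symAdj = λ { (inj₁ p) → inj₂ p ; (inj₂ p) → inj₁ p }
  ; irrefl = λ { {x} (inj₁ p) → n≢1+n (toℕ x) p ; {x} (inj₂ p) → n≢1+n (toℕ x) p }
  }

{-# OPTIONS --safe #-}

-- Delete a vertex v that does not disconnect G (one at
-- maximal distance from a root) and fix a neighbour u of v in H = G - v.  Convex sets of G
-- avoiding v are convex in H.  Convex sets containing v restrict to convex sets of H that either
-- contain u, or avoid u and all its neighbours (otherwise v – u – y breaks convexity).  The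
-- nonempty sets R of the second kind are sent injectively to non-convex sets of H containing u
-- by R ↦ R ∪ B(u, d(u, R) - 2).  Hence noc G ≤ noc H + 2^(n-2) + 1 ≤ 2^(n-1) + n.
-- If equality holds, H is extremal, v is a leaf (otherwise V(H) is convex in H but not in G),
-- and every non-convex set of H containing u is of the form above; among the extremal graphs
-- this leaves stars extended at their centre and paths extended at an end, that is K_{1,n-1},
-- P_4 and P_5.

module Submission where

open import Defs
open import Algebra.Properties.CommutativeSemigroup using (interchange)
open import Data.Bool using (true; false; T)
open import Data.Bool.Properties using (T?) renaming (_≟_ to _≟ᵇ_)
open import Data.Empty using (⊥; ⊥-elim)
open import Data.Fin using (Fin; zero; suc; toℕ; punchIn; punchOut; opposite; fromℕ; #_)
open import Data.Fin.Properties
  using (_≟_; all?; any?; ¬∀⟶∃¬; punchIn-injective; punchInᵢ≢i; punchIn-punchOut; punchOut-punchIn; punchOut-cong;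
         toℕ-injective; toℕ<n; opposite-prop; opposite-involutive)
import Data.Fin.Properties as Fin
open import Data.Fin.Permutation
  using (Permutation; _⟨$⟩ʳ_; _⟨$⟩ˡ_; inverseˡ; inverseʳ; flip; _∘ₚ_; transpose; insert; insert-punchIn; reverse; ↔⇒≡)
import Data.Fin.Permutation as Perm
open import Data.List using (List; []; _∷_; _++_; map; length; filter)
open import Data.List.Properties using (length-++; length-map; filter-++; filter-notAll; filter-all; filter-none)
open import Data.List.Membership.Propositional using (_∈_)
open import Data.List.Membership.Propositional.Properties
  using (∈-map⁺; ∈-map⁻; ∈-++⁺ˡ; ∈-++⁺ʳ; ∈-filter⁺; ∈-filter⁻)
open import Data.List.Relation.Unary.All as All using (All; []; _∷_)
open import Data.List.Relation.Unary.All.Properties using (all-filter)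
open import Data.List.Relation.Unary.Any as Any using (here; there)
open import Data.List.Relation.Unary.AllPairs using ([]; _∷_)
open import Data.List.Relation.Unary.Unique.Propositional using (Unique)
import Data.List.Relation.Unary.Unique.Propositional.Properties as Unique
open import Data.List.Relation.Binary.Sublist.Propositional using (⊆-refl)
open import Data.List.Relation.Binary.Sublist.Propositional.Properties using (filter⁺; length-mono-≤)
open import Data.Nat using (ℕ; zero; suc; _+_; _*_; _∸_; _^_; _≤_; _<_; z≤n; s≤s; s≤s⁻¹)
open import Data.Nat.Properties
  using (+-suc; +-comm; +-identityʳ; +-commutativeSemigroup; +-mono-≤; +-monoˡ-≤; +-monoʳ-≤; +-monoʳ-<;
         +-cancelˡ-≤; +-cancelʳ-≤; +-∸-assoc; ∸-cancelˡ-≡; suc-injective; ≤-refl; ≤-reflexive; ≤-trans;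
         ≤-antisym; <⇒≤; ≮⇒≥; <-irrefl; <-≤-trans; 1+n≰n; m≤m+n; m≤n+m; m≤n⇒m<n∨m≡n; module ≤-Reasoning)
open import Data.Nat.Tactic.RingSolver using (solve-∀)
open import Data.Product using (_×_; _,_; proj₁; proj₂; ∃; ∃₂; Σ; uncurry)
open import Data.Sum using (_⊎_; inj₁; inj₂; [_,_])
import Data.Sum
open import Data.Unit using (tt)
open import Data.Vec using ([]; _∷_; lookup; tabulate; insertAt; replicate)
open import Data.Vec.Properties
  using (≡-dec; ∷-injectiveʳ; lookup∘tabulate; tabulate∘lookup; tabulate-cong; insertAt-lookup; insertAt-punchIn;
         lookup-replicate)
open import Function using (_∘_; _⇔_; mk⇔; Equivalence)
open import Level using (0ℓ)
open import Relation.Nullary using (¬_; Dec; yes; no; ¬?; _×-dec_; _⊎-dec_; _→-dec_)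
open import Relation.Nullary.Decidable using (isYes; toWitness; fromWitness; toWitnessFalse)
open import Relation.Unary using (Pred; Decidable)
open import Relation.Unary.Properties using (∁?; _∪?_; _∩?_)
open import Relation.Binary using (DecidableEquality)
open import Relation.Binary.PropositionalEquality hiding ([_])

private
  variable
    k m n : ℕ

_∈?_ : (x : Fin n) (S : VSet n) → Dec (x ∈ₛ S)
x ∈? S = T? (lookup S x)

VSet-≟ : DecidableEquality (VSet n)
VSet-≟ = ≡-dec _≟ᵇ_

⟦_⟧ : {P : Pred (Fin n) 0ℓ} → Decidable P → VSet n
⟦ P? ⟧ = tabulate (isYes ∘ P?)

module _ {P : Pred (Fin n) 0ℓ} (P? : Decidable P) where

  ∈⟦⟧⁺ : ∀ {x} → P x → x ∈ₛ ⟦ P? ⟧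
  ∈⟦⟧⁺ {x} p = subst T (sym (lookup∘tabulate (isYes ∘ P?) x)) (fromWitness p)

  ∈⟦⟧⁻ : ∀ {x} → x ∈ₛ ⟦ P? ⟧ → P x
  ∈⟦⟧⁻ {x} x∈ = toWitness (subst T (lookup∘tabulate (isYes ∘ P?) x) x∈)

∈ₛ-ext : {S S′ : VSet n} → (∀ x → x ∈ₛ S ⇔ x ∈ₛ S′) → S ≡ S′
∈ₛ-ext {S = S} {S′} S⇔S′ = begin
  S                    ≡⟨ tabulate∘lookup S ⟨
  tabulate (lookup S)  ≡⟨ tabulate-cong (λ x → T-injective (S⇔S′ x)) ⟩
  tabulate (lookup S′) ≡⟨ tabulate∘lookup S′ ⟩
  S′                   ∎
  where
  open ≡-Reasoning
  T-injective : ∀ {a b} → T a ⇔ T b → a ≡ b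
  T-injective {false} {false} _ = refl
  T-injective {false} {true}  e = ⊥-elim (Equivalence.from e tt)
  T-injective {true}  {false} e = ⊥-elim (Equivalence.to e tt)
  T-injective {true}  {true}  _ = refl

∅ : VSet n
∅ = replicate _ false

∉∅ : ∀ {x : Fin n} → ¬ x ∈ₛ ∅
∉∅ {x = x} = subst T (lookup-replicate x false)

Nonempty : VSet n → Set
Nonempty S = ∃ (_∈ₛ S)

¬Nonempty⇒≡∅ : {S : VSet n} → ¬ Nonempty S → S ≡ ∅
¬Nonempty⇒≡∅ {n} S-empty = ∈ₛ-ext λ x → mk⇔ (λ x∈S → ⊥-elim (S-empty (x , x∈S))) (⊥-elim ∘ ∉∅ {n})

-- Counting families of vertex sets

module _ {A : Set} where

  length-filter-∪-∩ : {P Q : Pred A 0ℓ} (P? : Decidable P) (Q? : Decidable Q) → ∀ xs →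
    length (filter P? xs) + length (filter Q? xs) ≡
    length (filter (P? ∪? Q?) xs) + length (filter (P? ∩? Q?) xs)
  length-filter-∪-∩ P? Q? [] = refl
  length-filter-∪-∩ P? Q? (x ∷ xs) with ih ← length-filter-∪-∩ P? Q? xs | P? x | Q? x
  ... | yes _ | yes _ = cong suc (trans (+-suc _ _) (trans (cong suc ih) (sym (+-suc _ _))))
  ... | yes _ | no  _ = cong suc ih
  ... | no  _ | yes _ = trans (+-suc _ _) (cong suc ih)
  ... | no  _ | no  _ = ih

  Unique-length-≤ : DecidableEquality A → {xs ys : List A} → Unique xs →
                    (∀ {x} → x ∈ xs → x ∈ ys) → length xs ≤ length ys
  Unique-length-≤ _≟_ {[]} _ _ = z≤n
  Unique-length-≤ _≟_ {x ∷ xs} {ys} (x∉xs ∷ xs!) xs⊆ys =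
    ≤-trans (s≤s (Unique-length-≤ _≟_ xs! xs⊆ys-x))
            (filter-notAll (λ y → ¬? (x ≟ y)) ys (Any.map (λ x≡y x≢y → x≢y x≡y) (xs⊆ys (here refl))))
    where
    xs⊆ys-x : ∀ {y} → y ∈ xs → y ∈ filter (λ y → ¬? (x ≟ y)) ys
    xs⊆ys-x y∈xs = ∈-filter⁺ (λ y → ¬? (x ≟ y)) (xs⊆ys (there y∈xs)) (All.lookup x∉xs y∈xs)

  Unique-map-injectiveOn : {B : Set} {P : Pred A 0ℓ} (f : A → B) →
    (∀ {x y} → P x → P y → f x ≡ f y → x ≡ y) →
    ∀ {xs} → All P xs → Unique xs → Unique (map f xs)
  Unique-map-injectiveOn f inj [] [] = []
  Unique-map-injectiveOn {P = P} f inj {x ∷ _} (px ∷ pxs) (x∉xs ∷ xs!) =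
    fx∉ pxs x∉xs ∷ Unique-map-injectiveOn f inj pxs xs!
    where
    fx∉ : ∀ {ys} → All P ys → All (x ≢_) ys → All (f x ≢_) (map f ys)
    fx∉ [] [] = []
    fx∉ (py ∷ pys) (x≢y ∷ x≢ys) = (x≢y ∘ inj px py) ∷ fx∉ pys x≢ys

  length-filter-map : {B : Set} {P : Pred B 0ℓ} (P? : Decidable P) (f : A → B) → ∀ xs →
                        length (filter P? (map f xs)) ≡ length (filter (P? ∘ f) xs)
  length-filter-map P? f [] = refl
  length-filter-map P? f (x ∷ xs) with P? (f x)
  ... | yes _ = cong suc (length-filter-map P? f xs)
  ... | no  _ = length-filter-map P? f xs

∈-allVSets : (S : VSet n) → S ∈ allVSets n
∈-allVSets [] = here refl
∈-allVSets {suc n} (true ∷ S) = ∈-++⁺ˡ (∈-map⁺ (true ∷_) (∈-allVSets S))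
∈-allVSets {suc n} (false ∷ S) = ∈-++⁺ʳ (map (true ∷_) (allVSets n)) (∈-map⁺ (false ∷_) (∈-allVSets S))

allVSets-unique : ∀ n → Unique (allVSets n)
allVSets-unique zero = [] ∷ []
allVSets-unique (suc n) =
  Unique.++⁺ (Unique.map⁺ ∷-injectiveʳ (allVSets-unique n)) (Unique.map⁺ ∷-injectiveʳ (allVSets-unique n)) disjoint
  where
  disjoint : ∀ {S} → ¬ (S ∈ map (true ∷_) (allVSets n) × S ∈ map (false ∷_) (allVSets n))
  disjoint (S∈₁ , S∈₂) with ∈-map⁻ (true ∷_) S∈₁ | ∈-map⁻ (false ∷_) S∈₂
  ... | _ , _ , refl | _ , _ , ()

length-allVSets : ∀ n → length (allVSets n) ≡ 2 ^ n
length-allVSets zero = refl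
length-allVSets (suc n) = begin
  length (map (true ∷_) (allVSets n) ++ map (false ∷_) (allVSets n))
    ≡⟨ length-++ (map (true ∷_) (allVSets n)) ⟩
  length (map (true ∷_) (allVSets n)) + length (map (false ∷_) (allVSets n))
    ≡⟨ cong₂ _+_ (length-map (true ∷_) (allVSets n)) (length-map (false ∷_) (allVSets n)) ⟩
  length (allVSets n) + length (allVSets n)
    ≡⟨ cong₂ _+_ (length-allVSets n) (length-allVSets n) ⟩
  2 ^ n + 2 ^ n
    ≡⟨ cong (2 ^ n +_) (+-identityʳ (2 ^ n)) ⟨
  2 ^ suc n ∎
  where open ≡-Reasoning

count : {P : Pred (VSet n) 0ℓ} → Decidable P → ℕ
count {n} P? = length (filter P? (allVSets n))

module _ {P Q : Pred (VSet n) 0ℓ} (P? : Decidable P) (Q? : Decidable Q) where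

  count-mono : (∀ {S} → P S → Q S) → count P? ≤ count Q?
  count-mono P⊆Q = length-mono-≤ (filter⁺ P? Q? (λ { refl → P⊆Q }) (⊆-refl {x = allVSets n}))

  count-∪-∩ : count P? + count Q? ≡ count (P? ∪? Q?) + count (P? ∩? Q?)
  count-∪-∩ = length-filter-∪-∩ P? Q? (allVSets n)

count-cong : {P Q : Pred (VSet n) 0ℓ} (P? : Decidable P) (Q? : Decidable Q) →
             (∀ {S} → P S → Q S) → (∀ {S} → Q S → P S) → count P? ≡ count Q?
count-cong P? Q? P⊆Q Q⊆P = ≤-antisym (count-mono P? Q? P⊆Q) (count-mono Q? P? Q⊆P)

count-all : {P : Pred (VSet n) 0ℓ} (P? : Decidable P) → (∀ S → P S) → count P? ≡ 2 ^ n
count-all {n} P? all-P =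
  trans (cong length (filter-all P? {allVSets n} (All.tabulate λ {S} _ → all-P S))) (length-allVSets n)

count-none : {P : Pred (VSet n) 0ℓ} (P? : Decidable P) → (∀ S → ¬ P S) → count P? ≡ 0
count-none {n} P? no-P = cong length (filter-none P? {allVSets n} (All.tabulate λ {S} _ → no-P S))

module _ {P Q R : Pred (VSet n) 0ℓ} (P? : Decidable P) (Q? : Decidable Q) (R? : Decidable R) where
  open ≤-Reasoning

  count-∪ : (∀ {S} → R S → P S ⊎ Q S) → count R? ≤ count P? + count Q?
  count-∪ R⊆P∪Q = begin
    count R?                            ≤⟨ count-mono R? (P? ∪? Q?) R⊆P∪Q ⟩
    count (P? ∪? Q?)                    ≤⟨ m≤m+n _ _ ⟩
    count (P? ∪? Q?) + count (P? ∩? Q?) ≡⟨ count-∪-∩ P? Q? ⟨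
    count P? + count Q?                 ∎

  count-disjoint : (∀ {S} → P S → R S) → (∀ {S} → Q S → R S) → (∀ {S} → P S → ¬ Q S) →
                   count P? + count Q? ≤ count R?
  count-disjoint P⊆R Q⊆R P∩Q=∅ = begin
    count P? + count Q?                 ≡⟨ count-∪-∩ P? Q? ⟩
    count (P? ∪? Q?) + count (P? ∩? Q?) ≡⟨ cong (count (P? ∪? Q?) +_) (count-none (P? ∩? Q?) λ _ → uncurry P∩Q=∅) ⟩
    count (P? ∪? Q?) + 0                ≡⟨ +-identityʳ _ ⟩
    count (P? ∪? Q?)                    ≤⟨ count-mono (P? ∪? Q?) R? [ P⊆R , Q⊆R ] ⟩
    count R?                            ∎

count-∷ : {P : Pred (VSet (suc n)) 0ℓ} (P? : Decidable P) →
          count P? ≡ count (P? ∘ (true ∷_)) + count (P? ∘ (false ∷_))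
count-∷ {n} P? = begin
  length (filter P? (map (true ∷_) (allVSets n) ++ map (false ∷_) (allVSets n)))
    ≡⟨ cong length (filter-++ P? (map (true ∷_) (allVSets n)) _) ⟩
  length (filter P? (map (true ∷_) (allVSets n)) ++ filter P? (map (false ∷_) (allVSets n)))
    ≡⟨ length-++ (filter P? (map (true ∷_) (allVSets n))) ⟩
  length (filter P? (map (true ∷_) (allVSets n))) + length (filter P? (map (false ∷_) (allVSets n)))
    ≡⟨ cong₂ _+_ (length-filter-map P? (true ∷_) (allVSets n)) (length-filter-map P? (false ∷_) (allVSets n)) ⟩
  count (P? ∘ (true ∷_)) + count (P? ∘ (false ∷_)) ∎
  where open ≡-Reasoning

count-insertAt : {P : Pred (VSet (suc n)) 0ℓ} (P? : Decidable P) (v : Fin (suc n)) →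
  count P? ≡ count (λ S → P? (insertAt S v true)) + count (λ S → P? (insertAt S v false))
count-insertAt P? zero = count-∷ P?
count-insertAt {suc n} P? (suc v) = begin
  count P?
    ≡⟨ count-∷ P? ⟩
  count (P? ∘ (true ∷_)) + count (P? ∘ (false ∷_))
    ≡⟨ cong₂ _+_ (count-insertAt (P? ∘ (true ∷_)) v) (count-insertAt (P? ∘ (false ∷_)) v) ⟩
  (a + b) + (c + d)
    ≡⟨ interchange +-commutativeSemigroup a b c d ⟩
  (a + c) + (b + d)
    ≡⟨ cong₂ _+_ (count-∷ (λ S → P? (insertAt S (suc v) true))) (count-∷ (λ S → P? (insertAt S (suc v) false))) ⟨
  count (λ S → P? (insertAt S (suc v) true)) + count (λ S → P? (insertAt S (suc v) false)) ∎
  where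
  open ≡-Reasoning
  a b c d : ℕ
  a = count (λ S → P? (true ∷ insertAt S v true))
  b = count (λ S → P? (true ∷ insertAt S v false))
  c = count (λ S → P? (false ∷ insertAt S v true))
  d = count (λ S → P? (false ∷ insertAt S v false))

count-∈ : (u : Fin (suc n)) → count (u ∈?_) ≡ 2 ^ n
count-∈ {n} u = begin
  count (u ∈?_)
    ≡⟨ count-insertAt (u ∈?_) u ⟩
  count (λ S → u ∈? insertAt S u true) + count (λ S → u ∈? insertAt S u false)
    ≡⟨ cong₂ _+_ (count-all _ λ S → subst T (sym (insertAt-lookup S u true)) tt)
                 (count-none _ λ S → subst T (insertAt-lookup S u false)) ⟩
  2 ^ n + 0
    ≡⟨ +-identityʳ (2 ^ n) ⟩
  2 ^ n ∎
  where open ≡-Reasoning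

count-singleton : (S : VSet n) → count (λ S′ → VSet-≟ S′ S) ≡ 1
count-singleton [] = refl
count-singleton (b ∷ S) = trans (count-∷ (λ S′ → VSet-≟ S′ (b ∷ S))) (split b)
  where
  same-head : ∀ b → count (λ S′ → VSet-≟ (b ∷ S′) (b ∷ S)) ≡ 1
  same-head b = trans (count-cong (λ S′ → VSet-≟ (b ∷ S′) (b ∷ S)) (λ S′ → VSet-≟ S′ S) ∷-injectiveʳ (cong (b ∷_)))
                      (count-singleton S)
  split : ∀ b → count (λ S′ → VSet-≟ (true ∷ S′) (b ∷ S)) + count (λ S′ → VSet-≟ (false ∷ S′) (b ∷ S)) ≡ 1
  split true  = cong₂ _+_ (same-head true) (count-none (λ S′ → VSet-≟ (false ∷ S′) (true ∷ S)) λ _ ())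
  split false = cong₂ _+_ (count-none (λ S′ → VSet-≟ (true ∷ S′) (false ∷ S)) λ _ ()) (same-head false)

count-injection : {P : Pred (VSet m) 0ℓ} {Q : Pred (VSet n) 0ℓ} (P? : Decidable P) (Q? : Decidable Q)
  (f : VSet m → VSet n) → (∀ {S} → P S → Q (f S)) →
  (∀ {S S′} → P S → P S′ → f S ≡ f S′ → S ≡ S′) → count P? ≤ count Q?
count-injection {m} {n} P? Q? f f-maps f-inj = begin
  count P?                                ≡⟨ length-map f (filter P? (allVSets m)) ⟨
  length (map f (filter P? (allVSets m))) ≤⟨ Unique-length-≤ VSet-≟ image-unique image⊆Q ⟩
  count Q?                                ∎
  where
  open ≤-Reasoning
  image-unique : Unique (map f (filter P? (allVSets m)))
  image-unique = Unique-map-injectiveOn f f-inj (all-filter P? (allVSets m)) (Unique.filter⁺ P? (allVSets-unique m))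
  image⊆Q : ∀ {S} → S ∈ map f (filter P? (allVSets m)) → S ∈ filter Q? (allVSets n)
  image⊆Q S∈ with ∈-map⁻ f S∈
  ... | S′ , S′∈ , refl = ∈-filter⁺ Q? (∈-allVSets (f S′)) (f-maps (proj₂ (∈-filter⁻ P? {xs = allVSets m} S′∈)))

-- Deleting a vertex; walks and balls

infixl 25 _-_

_-_ : Graph (suc n) → Fin (suc n) → Graph n
G - v = record
  { Adj    = λ x y → Adj G (punchIn v x) (punchIn v y)
  ; adj?   = λ x y → adj? G (punchIn v x) (punchIn v y)
  ; symAdj = symAdj G
  ; irrefl = irrefl G
  }

Adj⇒≢ : (G : Graph n) → ∀ {x y} → Adj G x y → x ≢ y
Adj⇒≢ G x~y refl = irrefl G x~y

Adj-punchOut : (G : Graph (suc n)) (v : Fin (suc n)) → ∀ {x y} (v≢x : v ≢ x) (v≢y : v ≢ y) →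
               Adj G x y → Adj (G - v) (punchOut v≢x) (punchOut v≢y)
Adj-punchOut G v v≢x v≢y = subst₂ (Adj G) (sym (punchIn-punchOut v≢x)) (sym (punchIn-punchOut v≢y))

module _ {G : Graph n} where

  Reach-trans : ∀ {x y z} → Reach G x y → Reach G y z → Reach G x z
  Reach-trans here       q = q
  Reach-trans (step e p) q = step e (Reach-trans p q)

  Reach-sym : ∀ {x y} → Reach G x y → Reach G y x
  Reach-sym here       = here
  Reach-sym (step e p) = Reach-trans (Reach-sym p) (step (symAdj G e) here)

  Reach⇒neighbour : ∀ {x y} → Reach G x y → x ≢ y → ∃ (Adj G x)
  Reach⇒neighbour here         x≢x = ⊥-elim (x≢x refl)
  Reach⇒neighbour (step x~w _) _   = _ , x~w

minimal : {P : Pred ℕ 0ℓ} → Decidable P → ∀ {K} → P K → ∃ λ k → P k × (∀ {j} → j < k → ¬ P j)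
minimal P? {K} pK with P? 0
... | yes p0 = 0 , p0 , λ ()
minimal P? {zero}  pK | no ¬p0 = ⊥-elim (¬p0 pK)
minimal P? {suc K} pK | no ¬p0 with minimal (P? ∘ suc) {K} pK
... | k , pk , below = suc k , pk , λ { {zero} _ → ¬p0 ; {suc j} j<k → below (s≤s⁻¹ j<k) }

bounded : (f : Fin n → ℕ) → ∃ λ K → ∀ x → f x ≤ K
bounded {zero}  f = 0 , λ ()
bounded {suc n} f with bounded (f ∘ suc)
... | K , f≤K = f zero + K , λ { zero → m≤m+n (f zero) K ; (suc x) → ≤-trans (f≤K x) (m≤n+m K (f zero)) }

module Balls (G : Graph n) (r : Fin n) where

  Ball : ℕ → Pred (Fin n) 0ℓ
  Ball zero    x = x ≡ r
  Ball (suc k) x = Ball k x ⊎ ∃ λ y → Adj G x y × Ball k y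

  Ball? : ∀ k → Decidable (Ball k)
  Ball? zero    x = x ≟ r
  Ball? (suc k) x = Ball? k x ⊎-dec any? (λ y → adj? G x y ×-dec Ball? k y)

  Ball-mono : ∀ {k j} → k ≤ j → ∀ {x} → Ball k x → Ball j x
  Ball-mono {j = zero}  z≤n x∈ = x∈
  Ball-mono {j = suc j} k≤j x∈ with m≤n⇒m<n∨m≡n k≤j
  ... | inj₁ k<1+j = inj₁ (Ball-mono (s≤s⁻¹ k<1+j) x∈)
  ... | inj₂ refl  = x∈

  centre∈Ball : ∀ k → Ball k r
  centre∈Ball k = Ball-mono z≤n refl

  Reach⇒Ball : ∀ {x} → Reach G x r → ∃ λ k → Ball k x
  Reach⇒Ball here = 0 , refl
  Reach⇒Ball (step x~w p) with Reach⇒Ball p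
  ... | k , w∈ = suc k , inj₂ (_ , x~w , w∈)

  Connected⇒Ball : Connected G → ∃ λ K → ∀ x → Ball K x
  Connected⇒Ball connected with bounded (λ x → proj₁ (Reach⇒Ball (connected x r)))
  ... | K , k≤K = K , λ x → Ball-mono (k≤K x) (proj₂ (Reach⇒Ball (connected x r)))

  Ball-step : ∀ {k x} → Ball (suc k) x → ¬ Ball k x → ∃ λ y → Adj G x y × Ball k y
  Ball-step (inj₁ x∈) x∉ = ⊥-elim (x∉ x∈)
  Ball-step (inj₂ p)  _  = p

  Ball-step-exact : ∀ {k x} → Ball (suc (suc k)) x → ¬ Ball (suc k) x →
                    ∃ λ y → Adj G x y × Ball (suc k) y × ¬ Ball k y
  Ball-step-exact x∈ x∉ with Ball-step x∈ x∉
  ... | y , x~y , y∈ = y , x~y , y∈ , λ y∈′ → x∉ (inj₂ (y , x~y , y∈′))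

module _ (G : Graph (suc (suc m))) where
  open Balls G zero

  -- Walks descending from within distance k to the root stay within distance k, so they avoid v.
  outermost-non-separating : ∀ {k v} → (∀ x → Ball (suc k) x) → ¬ Ball k v → Connected (G - v)
  outermost-non-separating {k} {v} all∈ v∉ x y = Reach-trans (to-root′ x) (Reach-sym (to-root′ y))
    where
    v≢root : v ≢ zero
    v≢root v≡0 = v∉ (subst (Ball k) (sym v≡0) (centre∈Ball k))
    root′ : Fin (suc m)
    root′ = punchOut v≢root
    inner : ∀ {j} → j ≤ k → ∀ {x} → Ball j x → (v≢x : v ≢ x) → Reach (G - v) (punchOut v≢x) root′
    inner {zero}  _   refl v≢x = subst (λ x′ → Reach (G - v) x′ root′) (punchOut-cong v refl) here
    inner {suc j} j<k (inj₁ x∈) v≢x = inner (<⇒≤ j<k) x∈ v≢x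
    inner {suc j} j<k (inj₂ (y , x~y , y∈)) v≢x =
      step (Adj-punchOut G v v≢x v≢y x~y) (inner (<⇒≤ j<k) y∈ v≢y)
      where
      v≢y : v ≢ y
      v≢y refl = v∉ (Ball-mono (<⇒≤ j<k) y∈)
    to-root : ∀ {x} (v≢x : v ≢ x) → Reach (G - v) (punchOut v≢x) root′
    to-root {x} v≢x with Ball? k x
    ... | yes x∈ = inner ≤-refl x∈ v≢x
    ... | no  x∉ with Ball-step (all∈ x) x∉
    ...   | y , x~y , y∈ = step (Adj-punchOut G v v≢x v≢y x~y) (inner ≤-refl y∈ v≢y)
      where
      v≢y : v ≢ y
      v≢y refl = v∉ y∈
    to-root′ : ∀ x → Reach (G - v) x root′
    to-root′ x = subst (λ x′ → Reach (G - v) x′ root′) (punchOut-punchIn v) (to-root (punchInᵢ≢i v x ∘ sym))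

  non-separating-vertex : Connected G → ∃ λ v → Connected (G - v)
  non-separating-vertex connected with minimal (λ k → all? (Ball? k)) (proj₂ (Connected⇒Ball connected))
  ... | zero  , all∈ , _ with () ← all∈ (suc zero)
  ... | suc k , all∈ , below with ¬∀⟶∃¬ _ (Ball k) (Ball? k) (below ≤-refl)
  ...   | v , v∉ = v , outermost-non-separating all∈ v∉

record Breach (H : Graph n) (S : VSet n) : Set where
  constructor breach
  field
    a z b : Fin n
    a≢z   : a ≢ z
    z≢b   : z ≢ b
    a≢b   : a ≢ b
    a~z   : Adj H a z
    z~b   : Adj H z b
    a∈S   : a ∈ₛ S
    b∈S   : b ∈ₛ S
    z∉S   : ¬ z ∈ₛ S

Breach⇒nonconvex : {H : Graph n} {S : VSet n} → Breach H S → ¬ P3Convex H S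
Breach⇒nonconvex (breach a z b a≢z z≢b a≢b a~z z~b a∈S b∈S z∉S) convex =
  z∉S (convex a z b a≢z z≢b a≢b a~z z~b a∈S b∈S)

SplitsNeighbourhood : (H : Graph n) → Fin n → VSet n → Set
SplitsNeighbourhood H u Q = ∃₂ λ x y → Adj H u x × x ∈ₛ Q × Adj H u y × ¬ y ∈ₛ Q

AvoidsNeighbourhood : (H : Graph n) → Fin n → VSet n → Set
AvoidsNeighbourhood H u Q = ∃ (Adj H u) × (∀ y → Adj H u y → ¬ y ∈ₛ Q) ×
                            Σ (Breach H Q) λ β → Breach.a β ≢ u × Breach.b β ≢ u

-- Certifies that a non-convex set containing u is not of the form  fill R  (fill≢unmatched),
-- which makes the key inequality strict.
record UnmatchedSet (H : Graph n) (u : Fin n) : Set where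
  constructor unmatched
  field
    Q         : VSet n
    u∈Q       : u ∈ₛ Q
    nonconvex : ¬ P3Convex H Q
    position  : SplitsNeighbourhood H u Q ⊎ AvoidsNeighbourhood H u Q

module KeyInequality (H : Graph (suc m)) (connected : Connected H) (u : Fin (suc m)) where
  open Balls H u

  V : Set
  V = VSet (suc m)

  AvoidsN[u] : Pred V 0ℓ
  AvoidsN[u] S = ¬ u ∈ₛ S × (∀ y → Adj H u y → ¬ y ∈ₛ S)

  Far : Pred V 0ℓ
  Far S = AvoidsN[u] S × Nonempty S

  avoidsN[u]? : Decidable AvoidsN[u]
  avoidsN[u]? S = ¬? (u ∈? S) ×-dec all? λ y → adj? H u y →-dec ¬? (y ∈? S)

  convex∋u? : Decidable (λ S → P3Convex H S × u ∈ₛ S)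
  convex∋u? = P3Convex? H ∩? (u ∈?_)

  nonconvex∋u? : Decidable (λ S → ¬ P3Convex H S × u ∈ₛ S)
  nonconvex∋u? = ∁? (P3Convex? H) ∩? (u ∈?_)

  nonconvex∋u-except? : (Q : V) → Decidable (λ S → (¬ P3Convex H S × u ∈ₛ S) × S ≢ Q)
  nonconvex∋u-except? Q = nonconvex∋u? ∩? λ S → ¬? (VSet-≟ S Q)

  convex-avoiding? : Decidable (λ S → P3Convex H S × AvoidsN[u] S)
  convex-avoiding? = P3Convex? H ∩? avoidsN[u]?

  convex-far? : Decidable (λ S → P3Convex H S × Far S)
  convex-far? = P3Convex? H ∩? (avoidsN[u]? ∩? λ S → any? (_∈? S))

  Meets : V → ℕ → Set
  Meets R k = ∃ λ x → x ∈ₛ R × Ball k x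

  nearest : ∀ R → Nonempty R → ∃ λ k → Meets R k × (∀ {j} → j < k → ¬ Meets R j)
  nearest R (x , x∈R) = minimal (λ k → any? λ x → x ∈? R ×-dec Ball? k x) (x , x∈R , proj₂ (Reach⇒Ball (connected x u)))

  -- d(u, R), with junk value 0 for empty R.
  distance : V → ℕ
  distance R with any? (_∈? R)
  ... | yes R≠∅ = proj₁ (nearest R R≠∅)
  ... | no  _   = 0

  distance-minimal : ∀ R → Nonempty R → Meets R (distance R) × (∀ {j} → j < distance R → ¬ Meets R j)
  distance-minimal R R≠∅ with any? (_∈? R)
  ... | yes R≠∅′ = proj₂ (nearest R R≠∅′)
  ... | no  R=∅  = ⊥-elim (R=∅ R≠∅)

  radius : V → ℕ
  radius R = distance R ∸ 2

  -- The ball stops two steps short of R: the first vertex outside it on a shortest path from R to u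
  -- breaks convexity, and R can be recovered from  fill R.
  fill : V → V
  fill R = ⟦ (λ x → x ∈? R ⊎-dec Ball? (radius R) x) ⟧

  ∈fill⁺ˡ : ∀ R {x} → x ∈ₛ R → x ∈ₛ fill R
  ∈fill⁺ˡ R = ∈⟦⟧⁺ (λ x → x ∈? R ⊎-dec Ball? (radius R) x) ∘ inj₁

  ∈fill⁺ʳ : ∀ R {x} → Ball (radius R) x → x ∈ₛ fill R
  ∈fill⁺ʳ R = ∈⟦⟧⁺ (λ x → x ∈? R ⊎-dec Ball? (radius R) x) ∘ inj₂

  ∈fill⁻ : ∀ R {x} → x ∈ₛ fill R → x ∈ₛ R ⊎ Ball (radius R) x
  ∈fill⁻ R = ∈⟦⟧⁻ (λ x → x ∈? R ⊎-dec Ball? (radius R) x)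

  module FarSet (R : V) (R-far : Far R) where

    distance≡ : distance R ≡ suc (suc (radius R))
    distance≡ with distance R | distance-minimal R (proj₂ R-far)
    ... | zero        | (x , x∈R , refl) , _ = ⊥-elim (proj₁ (proj₁ R-far) x∈R)
    ... | suc zero    | (x , x∈R , inj₁ refl) , _ = ⊥-elim (proj₁ (proj₁ R-far) x∈R)
    ... | suc zero    | (x , x∈R , inj₂ (_ , x~u , refl)) , _ = ⊥-elim (proj₂ (proj₁ R-far) x (symAdj H x~u) x∈R)
    ... | suc (suc _) | _ = refl

    ∉Ball : ∀ {x} → x ∈ₛ R → ¬ Ball (suc (radius R)) x
    ∉Ball x∈R x∈B = proj₂ (distance-minimal R (proj₂ R-far)) (≤-reflexive (sym distance≡)) (_ , x∈R , x∈B)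

    sphere∉fill : ∀ {y} → Ball (suc (radius R)) y → ¬ Ball (radius R) y → ¬ y ∈ₛ fill R
    sphere∉fill y∈B y∉B y∈ with ∈fill⁻ R y∈
    ... | inj₁ y∈R = ∉Ball y∈R y∈B
    ... | inj₂ y∈B′ = y∉B y∈B′

    path-to-R : ∃₂ λ x y → ∃ λ w → x ∈ₛ R × Adj H x y × Adj H y w ×
                Ball (suc (radius R)) y × ¬ Ball (radius R) y × Ball (radius R) w
    path-to-R with subst (Meets R) distance≡ (proj₁ (distance-minimal R (proj₂ R-far)))
    ... | x , x∈R , x∈B with Ball-step-exact x∈B (∉Ball x∈R)
    ...   | y , x~y , y∈B , y∉B with Ball-step y∈B y∉B
    ...     | w , y~w , w∈B = x , y , w , x∈R , x~y , y~w , y∈B , y∉B , w∈B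

    fill-nonconvex : ¬ P3Convex H (fill R)
    fill-nonconvex with path-to-R
    ... | x , y , w , x∈R , x~y , y~w , y∈B , y∉B , w∈B = Breach⇒nonconvex {H = H} {S = fill R}
      (breach x y w (Adj⇒≢ H x~y) (Adj⇒≢ H y~w) x≢w x~y y~w (∈fill⁺ˡ R x∈R) (∈fill⁺ʳ R w∈B) (sphere∉fill y∈B y∉B))
      where
      x≢w : x ≢ w
      x≢w refl = ∉Ball x∈R (inj₁ w∈B)

    u∈fill : u ∈ₛ fill R
    u∈fill = ∈fill⁺ʳ R (centre∈Ball (radius R))

  fill-radius-≤ : ∀ R R′ → Far R → Far R′ → fill R ≡ fill R′ → radius R ≤ radius R′
  fill-radius-≤ R R′ R-far R′-far eq with FarSet.path-to-R R′ R′-far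
  ... | _ , y , _ , _ , _ , _ , y∈B , y∉B , _ = ≮⇒≥ λ r′<r →
    FarSet.sphere∉fill R′ R′-far y∈B y∉B (subst (y ∈ₛ_) eq (∈fill⁺ʳ R (Ball-mono r′<r y∈B)))

  fill-injective : ∀ {R R′} → Far R → Far R′ → fill R ≡ fill R′ → R ≡ R′
  fill-injective {R} {R′} R-far R′-far eq = ∈ₛ-ext λ x → mk⇔ (⊆ R R′ R-far R′-far eq) (⊆ R′ R R′-far R-far (sym eq))
    where
    ⊆ : ∀ R R′ → Far R → Far R′ → fill R ≡ fill R′ → ∀ {x} → x ∈ₛ R → x ∈ₛ R′
    ⊆ R R′ R-far R′-far eq {x} x∈R with ∈fill⁻ R′ (subst (x ∈ₛ_) eq (∈fill⁺ˡ R x∈R))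
    ... | inj₁ x∈R′ = x∈R′
    ... | inj₂ x∈B  = ⊥-elim (FarSet.∉Ball R R-far x∈R (inj₁ (subst (λ r → Ball r x) r′≡r x∈B)))
      where
      r′≡r : radius R′ ≡ radius R
      r′≡r = ≤-antisym (fill-radius-≤ R′ R R′-far R-far (sym eq)) (fill-radius-≤ R R′ R-far R′-far eq)

  module _ (R : V) where

    N[u]⊆fill : ∀ {r} → radius R ≡ suc r → ∀ {y} → Adj H u y → y ∈ₛ fill R
    N[u]⊆fill r≡ {y} u~y =
      ∈fill⁺ʳ R (subst (λ r → Ball r y) (sym r≡) (Ball-mono (s≤s z≤n) (inj₂ (u , symAdj H u~y , refl))))

    fill∖u⊆ : radius R ≡ 0 → ∀ {x} → x ∈ₛ fill R → x ≢ u → x ∈ₛ R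
    fill∖u⊆ r≡0 {x} x∈ x≢u with ∈fill⁻ R x∈
    ... | inj₁ x∈R = x∈R
    ... | inj₂ x∈B = ⊥-elim (x≢u (subst (λ r → Ball r x) r≡0 x∈B))

  -- If  radius R > 0  then  fill R  contains every neighbour of u; if  radius R = 0  it is  R ∪ {u}.
  fill≢unmatched : ∀ R → P3Convex H R → Far R → (W : UnmatchedSet H u) → fill R ≢ UnmatchedSet.Q W
  fill≢unmatched R R-convex ((u∉R , N[u]∩R=∅) , _) (unmatched _ _ _ position) refl = miss (radius R) refl position
    where
    miss : ∀ r → radius R ≡ r → SplitsNeighbourhood H u (fill R) ⊎ AvoidsNeighbourhood H u (fill R) → ⊥
    miss zero    r≡0 (inj₁ (x , _ , u~x , x∈ , _)) = N[u]∩R=∅ x u~x (fill∖u⊆ R r≡0 x∈ (Adj⇒≢ H u~x ∘ sym))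
    miss (suc _) r≡s (inj₁ (_ , y , _ , _ , u~y , y∉)) = y∉ (N[u]⊆fill R r≡s u~y)
    miss zero    r≡0 (inj₂ (_ , _ , breach a z b a≢z z≢b a≢b a~z z~b a∈ b∈ z∉ , a≢u , b≢u)) =
      z∉ (∈fill⁺ˡ R (R-convex a z b a≢z z≢b a≢b a~z z~b (fill∖u⊆ R r≡0 a∈ a≢u) (fill∖u⊆ R r≡0 b∈ b≢u)))
    miss (suc _) r≡s (inj₂ ((y , u~y) , N[u]∩fill=∅ , _)) = N[u]∩fill=∅ y u~y (N[u]⊆fill R r≡s u~y)

  count-∋u : count convex∋u? + count nonconvex∋u? ≤ 2 ^ m
  count-∋u = begin
    count convex∋u? + count nonconvex∋u? ≤⟨ count-disjoint convex∋u? nonconvex∋u? (u ∈?_) proj₂ proj₂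
                                                           (λ (convex , _) (nonconvex , _) → nonconvex convex) ⟩
    count (u ∈?_)                        ≡⟨ count-∈ u ⟩
    2 ^ m                                ∎
    where open ≤-Reasoning

  count-convex-avoiding : count convex-avoiding? ≤ suc (count convex-far?)
  count-convex-avoiding = begin
    count convex-avoiding?
      ≤⟨ count-∪ (λ S → VSet-≟ S (∅ {suc m})) convex-far? convex-avoiding? ∅-or-far ⟩
    count (λ S → VSet-≟ S (∅ {suc m})) + count convex-far?
      ≡⟨ cong (_+ count convex-far?) (count-singleton (∅ {suc m})) ⟩
    suc (count convex-far?) ∎
    where
    open ≤-Reasoning
    ∅-or-far : ∀ {S} → P3Convex H S × AvoidsN[u] S → S ≡ ∅ {suc m} ⊎ P3Convex H S × Far S
    ∅-or-far {S} (convex , avoids) with any? (_∈? S)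
    ... | yes S≠∅ = inj₂ (convex , avoids , S≠∅)
    ... | no  S=∅ = inj₁ (¬Nonempty⇒≡∅ S=∅)

  count-with-u+avoiding : count convex∋u? + count convex-avoiding? ≤ suc (count convex∋u? + count convex-far?)
  count-with-u+avoiding = ≤-trans (+-monoʳ-≤ (count convex∋u?) count-convex-avoiding) (≤-reflexive (+-suc _ _))

  fill-maps : ∀ {R} → P3Convex H R × Far R → ¬ P3Convex H (fill R) × u ∈ₛ fill R
  fill-maps {R} (_ , far) = FarSet.fill-nonconvex R far , FarSet.u∈fill R far

  count-far≤nonconvex : count convex-far? ≤ count nonconvex∋u?
  count-far≤nonconvex = count-injection convex-far? nonconvex∋u? fill (λ {R} → fill-maps {R})
    (λ (_ , far) (_ , far′) → fill-injective far far′)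

  count-far≤nonconvex-except : ∀ Q → (∀ R → P3Convex H R → Far R → fill R ≢ Q) →
                               count convex-far? ≤ count (nonconvex∋u-except? Q)
  count-far≤nonconvex-except Q fill≢Q = count-injection convex-far? (nonconvex∋u-except? Q) fill
    (λ {R} (convex , far) → fill-maps {R} (convex , far) , fill≢Q R convex far)
    (λ (_ , far) (_ , far′) → fill-injective far far′)

  key : count convex∋u? + count convex-avoiding? ≤ suc (2 ^ m)
  key = ≤-trans count-with-u+avoiding (s≤s (≤-trans (+-monoʳ-≤ (count convex∋u?) count-far≤nonconvex) count-∋u))

  key-strict : UnmatchedSet H u → count convex∋u? + count convex-avoiding? ≤ 2 ^ m
  key-strict W = ≤-trans count-with-u+avoiding (≤-trans (+-monoʳ-< (count convex∋u?) count-far<nonconvex) count-∋u)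
    where
    open UnmatchedSet W
    count-far<nonconvex : count convex-far? < count nonconvex∋u?
    count-far<nonconvex = begin
      suc (count convex-far?)
        ≤⟨ s≤s (count-far≤nonconvex-except Q λ R convex far → fill≢unmatched R convex far W) ⟩
      suc (count (nonconvex∋u-except? Q))
        ≡⟨ +-comm 1 _ ⟩
      count (nonconvex∋u-except? Q) + 1
        ≡⟨ cong (count (nonconvex∋u-except? Q) +_) (count-singleton Q) ⟨
      count (nonconvex∋u-except? Q) + count (λ S → VSet-≟ S Q)
        ≤⟨ count-disjoint (nonconvex∋u-except? Q) (λ S → VSet-≟ S Q) nonconvex∋u? proj₁
                          (λ { refl → nonconvex , u∈Q }) proj₂ ⟩
      count nonconvex∋u? ∎
      where open ≤-Reasoning

-- Isomorphisms

module _ {G : Graph n} {K : Graph m} (ψ : G ≅ K) where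
  open _≅_ ψ

  to : Fin n → Fin m
  to = bij ⟨$⟩ʳ_

  from : Fin m → Fin n
  from = bij ⟨$⟩ˡ_

  to-injective : ∀ {x y} → to x ≡ to y → x ≡ y
  to-injective {x} {y} eq = trans (sym (inverseˡ bij)) (trans (cong from eq) (inverseˡ bij))

  from-injective : ∀ {x y} → from x ≡ from y → x ≡ y
  from-injective {x} {y} eq = trans (sym (inverseʳ bij)) (trans (cong to eq) (inverseʳ bij))

  from-to : ∀ {x y} → to x ≡ y → from y ≡ x
  from-to refl = inverseˡ bij

  reflect-from : ∀ x y → Adj K x y → Adj G (from x) (from y)
  reflect-from x y = reflect (from x) (from y) ∘ subst₂ (Adj K) (sym (inverseʳ bij)) (sym (inverseʳ bij))

≅-sym : {G : Graph n} {K : Graph m} → G ≅ K → K ≅ G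
≅-sym {K = K} ψ = record
  { bij      = flip (_≅_.bij ψ)
  ; preserve = reflect-from ψ
  ; reflect  = λ x y → subst₂ (Adj K) (inverseʳ (_≅_.bij ψ)) (inverseʳ (_≅_.bij ψ)) ∘ _≅_.preserve ψ (from ψ x) (from ψ y)
  }

≅-trans : {G : Graph n} {H : Graph m} {K : Graph k} → G ≅ H → H ≅ K → G ≅ K
≅-trans ψ χ = record
  { bij      = _≅_.bij ψ ∘ₚ _≅_.bij χ
  ; preserve = λ x y → _≅_.preserve χ (to ψ x) (to ψ y) ∘ _≅_.preserve ψ x y
  ; reflect  = λ x y → _≅_.reflect ψ x y ∘ _≅_.reflect χ (to ψ x) (to ψ y)
  }

module Transport {G : Graph n} {K : Graph m} (ψ : G ≅ K) where
  open _≅_ ψ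

  pull : VSet m → VSet n
  pull Q = ⟦ (λ x → to ψ x ∈? Q) ⟧

  ∈pull⁺ : ∀ Q {x} → to ψ x ∈ₛ Q → x ∈ₛ pull Q
  ∈pull⁺ Q = ∈⟦⟧⁺ (λ x → to ψ x ∈? Q)

  ∈pull⁻ : ∀ Q {x} → x ∈ₛ pull Q → to ψ x ∈ₛ Q
  ∈pull⁻ Q = ∈⟦⟧⁻ (λ x → to ψ x ∈? Q)

  from∈pull⁺ : ∀ Q {y} → y ∈ₛ Q → from ψ y ∈ₛ pull Q
  from∈pull⁺ Q {y} = ∈pull⁺ Q ∘ subst (_∈ₛ Q) (sym (inverseʳ bij))

  from∈pull⁻ : ∀ Q {y} → from ψ y ∈ₛ pull Q → y ∈ₛ Q
  from∈pull⁻ Q {y} = subst (_∈ₛ Q) (inverseʳ bij) ∘ ∈pull⁻ Q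

  pull-convex : ∀ Q → P3Convex K Q → P3Convex G (pull Q)
  pull-convex Q convex a z b a≢z z≢b a≢b a~z z~b a∈ b∈ = ∈pull⁺ Q
    (convex (to ψ a) (to ψ z) (to ψ b) (a≢z ∘ to-injective ψ) (z≢b ∘ to-injective ψ) (a≢b ∘ to-injective ψ)
            (preserve a z a~z) (preserve z b z~b) (∈pull⁻ Q a∈) (∈pull⁻ Q b∈))

  pull-convex⁻ : ∀ Q → P3Convex G (pull Q) → P3Convex K Q
  pull-convex⁻ Q convex a z b a≢z z≢b a≢b a~z z~b a∈ b∈ = from∈pull⁻ Q
    (convex (from ψ a) (from ψ z) (from ψ b) (a≢z ∘ from-injective ψ) (z≢b ∘ from-injective ψ) (a≢b ∘ from-injective ψ)
            (reflect-from ψ a z a~z) (reflect-from ψ z b z~b) (from∈pull⁺ Q a∈) (from∈pull⁺ Q b∈))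

  pull-injective : ∀ {Q Q′} → pull Q ≡ pull Q′ → Q ≡ Q′
  pull-injective {Q} {Q′} eq = ∈ₛ-ext λ y →
    mk⇔ (λ y∈Q → from∈pull⁻ Q′ (subst (from ψ y ∈ₛ_) eq (from∈pull⁺ Q y∈Q)))
        (λ y∈Q′ → from∈pull⁻ Q (subst (from ψ y ∈ₛ_) (sym eq) (from∈pull⁺ Q′ y∈Q′)))

  noc-≤ : noc K ≤ noc G
  noc-≤ = count-injection (P3Convex? K) (P3Convex? G) pull (λ {Q} → pull-convex Q) (λ _ _ → pull-injective)

  pull-breach : ∀ {Q} → Breach K Q → Breach G (pull Q)
  pull-breach {Q} (breach a z b a≢z z≢b a≢b a~z z~b a∈ b∈ z∉) =
    breach (from ψ a) (from ψ z) (from ψ b) (a≢z ∘ from-injective ψ) (z≢b ∘ from-injective ψ) (a≢b ∘ from-injective ψ)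
           (reflect-from ψ a z a~z) (reflect-from ψ z b z~b) (from∈pull⁺ Q a∈) (from∈pull⁺ Q b∈) (z∉ ∘ from∈pull⁻ Q)

  unmatched-pull : ∀ u → UnmatchedSet K (to ψ u) → UnmatchedSet G u
  unmatched-pull u (unmatched Q u∈Q nonconvex position) =
    unmatched (pull Q) (∈pull⁺ Q u∈Q) (nonconvex ∘ pull-convex⁻ Q) (pull-position position)
    where
    u~from : ∀ {y} → Adj K (to ψ u) y → Adj G u (from ψ y)
    u~from {y} = reflect u (from ψ y) ∘ subst (Adj K (to ψ u)) (sym (inverseʳ bij))
    from≢u : ∀ {y} → y ≢ to ψ u → from ψ y ≢ u
    from≢u y≢u from-y≡u = y≢u (trans (sym (inverseʳ bij)) (cong (to ψ) from-y≡u))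
    pull-position : SplitsNeighbourhood K (to ψ u) Q ⊎ AvoidsNeighbourhood K (to ψ u) Q →
                    SplitsNeighbourhood G u (pull Q) ⊎ AvoidsNeighbourhood G u (pull Q)
    pull-position (inj₁ (x , y , u~x , x∈ , u~y , y∉)) =
      inj₁ (from ψ x , from ψ y , u~from u~x , from∈pull⁺ Q x∈ , u~from u~y , y∉ ∘ from∈pull⁻ Q)
    pull-position (inj₂ ((y , u~y) , N∩Q=∅ , β , a≢u , b≢u)) =
      inj₂ ((from ψ y , u~from u~y) , (λ x u~x x∈ → N∩Q=∅ (to ψ x) (preserve u x u~x) (∈pull⁻ Q x∈)) ,
            pull-breach β , from≢u a≢u , from≢u b≢u)

noc-≅ : {G : Graph n} {K : Graph m} → G ≅ K → noc G ≡ noc K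
noc-≅ ψ = ≤-antisym (Transport.noc-≤ (≅-sym ψ)) (Transport.noc-≤ ψ)

StarCentre : Graph n → Fin n → Set
StarCentre G c = (∀ x → x ≢ c → Adj G c x) × (∀ x y → x ≢ c → y ≢ c → ¬ Adj G x y)

StarCentre? : (G : Graph n) (c : Fin n) → Dec (StarCentre G c)
StarCentre? G c = (all? λ x → ¬? (x ≟ c) →-dec adj? G c x)
             ×-dec (all? λ x → all? λ y → ¬? (x ≟ c) →-dec ¬? (y ≟ c) →-dec ¬? (adj? G x y))

StarCentre-from : {G : Graph n} {K : Graph m} (ψ : G ≅ K) → ∀ {c} → StarCentre K c → StarCentre G (from ψ c)
StarCentre-from {G = G} ψ {c} (c~ , ≁) =
  (λ x x≢c → subst (Adj G (from ψ c)) (inverseˡ bij) (reflect-from ψ c (to ψ x) (c~ (to ψ x) (to≢c x≢c)))) ,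
  (λ x y x≢c y≢c x~y → ≁ (to ψ x) (to ψ y) (to≢c x≢c) (to≢c y≢c) (preserve x y x~y))
  where
  open _≅_ ψ
  to≢c : ∀ {x} → x ≢ from ψ c → to ψ x ≢ c
  to≢c x≢c to-x≡c = x≢c (trans (sym (inverseˡ bij)) (cong (from ψ) to-x≡c))

StarCentre⇒≅star : (G : Graph (suc n)) → ∀ {c} → StarCentre G c → G ≅ star (suc n)
StarCentre⇒≅star {n} G {c} (c~ , ≁) = record { bij = π ; preserve = preserve ; reflect = reflect }
  where
  π : Permutation (suc n) (suc n)
  π = transpose c zero
  centre : ∀ {x} → toℕ (π ⟨$⟩ʳ x) ≡ 0 → x ≡ c
  centre {x} π-x≡0 = trans (sym (inverseˡ π)) (cong (π ⟨$⟩ˡ_) (toℕ-injective π-x≡0))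
  centre⁻ : ∀ {x} → x ≡ c → toℕ (π ⟨$⟩ʳ x) ≡ 0
  centre⁻ refl = cong toℕ (inverseʳ π {zero})
  preserve : ∀ x y → Adj G x y → StarAdj (π ⟨$⟩ʳ x) (π ⟨$⟩ʳ y)
  preserve x y x~y = by-cases (x ≟ c) (y ≟ c)
    where
    by-cases : Dec (x ≡ c) → Dec (y ≡ c) → StarAdj (π ⟨$⟩ʳ x) (π ⟨$⟩ʳ y)
    by-cases (yes x≡c) _         = inj₁ (centre⁻ x≡c , λ π-y≡0 → Adj⇒≢ G x~y (trans x≡c (sym (centre π-y≡0))))
    by-cases (no  x≢c) (yes y≡c) = inj₂ ((λ π-x≡0 → Adj⇒≢ G x~y (trans (centre π-x≡0) (sym y≡c))) , centre⁻ y≡c)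
    by-cases (no  x≢c) (no  y≢c) = ⊥-elim (≁ x y x≢c y≢c x~y)
  reflect : ∀ x y → StarAdj (π ⟨$⟩ʳ x) (π ⟨$⟩ʳ y) → Adj G x y
  reflect x y (inj₁ (π-x≡0 , π-y≢0)) = subst (λ x → Adj G x y) (sym (centre π-x≡0)) (c~ y (π-y≢0 ∘ centre⁻))
  reflect x y (inj₂ (π-x≢0 , π-y≡0)) = symAdj G (subst (λ y → Adj G y x) (sym (centre π-y≡0)) (c~ x (π-x≢0 ∘ centre⁻)))

Pendant : Graph n → Fin n → Fin n → Set
Pendant G v x = Adj G v x × (∀ y → Adj G v y → y ≡ x)

data PunchInView (v : Fin (suc n)) : Fin (suc n) → Set where
  at      : PunchInView v v
  punched : ∀ a → PunchInView v (punchIn v a)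

punchInView : (v x : Fin (suc n)) → PunchInView v x
punchInView v x with v ≟ x
... | yes refl = at
... | no  v≢x  = subst (PunchInView v) (punchIn-punchOut v≢x) (punched (punchOut v≢x))

module _ (G : Graph (suc n)) (v : Fin (suc n)) {u : Fin n} (pendant : Pendant G v (punchIn v u)) where

  pendant-neighbour : ∀ {a} → Adj G v (punchIn v a) → a ≡ u
  pendant-neighbour v~a = punchIn-injective v _ _ (proj₂ pendant _ v~a)

  StarCentre-extend : StarCentre (G - v) u → StarCentre G (punchIn v u)
  StarCentre-extend (u~ , ≁) = centre , leaves
    where
    centre : ∀ x → x ≢ punchIn v u → Adj G (punchIn v u) x
    centre x x≢u with punchInView v x
    ... | at        = symAdj G (proj₁ pendant)
    ... | punched a = u~ a (x≢u ∘ cong (punchIn v))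
    leaves : ∀ x y → x ≢ punchIn v u → y ≢ punchIn v u → ¬ Adj G x y
    leaves x y x≢u y≢u x~y with punchInView v x | punchInView v y
    ... | at        | _         = y≢u (proj₂ pendant y x~y)
    ... | punched _ | at        = x≢u (proj₂ pendant x (symAdj G x~y))
    ... | punched a | punched b = ≁ a b (x≢u ∘ cong (punchIn v)) (y≢u ∘ cong (punchIn v)) x~y

insert-self : (i : Fin (suc m)) (j : Fin (suc n)) (π : Permutation m n) → insert i j π ⟨$⟩ʳ i ≡ j
insert-self i j π with i ≟ i
... | yes _   = refl
... | no  i≢i = ⊥-elim (i≢i refl)

module _ {G : Graph (suc n)} {K : Graph (suc m)} {v w} (ψ : G - v ≅ K - w) {u : Fin n}
         (G-pendant : Pendant G v (punchIn v u)) (K-pendant : Pendant K w (punchIn w (to ψ u))) where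
  private
    π : Permutation n m
    π = _≅_.bij ψ

    Φ : Permutation (suc n) (suc m)
    Φ = insert v w π

    Φ-punchIn : ∀ a → Φ ⟨$⟩ʳ punchIn v a ≡ punchIn w (to ψ a)
    Φ-punchIn = insert-punchIn v w π

    preserve-v : ∀ {b} → Adj G v (punchIn v b) → Adj K (Φ ⟨$⟩ʳ v) (Φ ⟨$⟩ʳ punchIn v b)
    preserve-v {b} v~b = subst₂ (Adj K) (sym (insert-self v w π)) (sym (Φ-punchIn b))
      (subst (λ a → Adj K w (punchIn w (to ψ a))) (sym (pendant-neighbour G v G-pendant v~b)) (proj₁ K-pendant))

    reflect-v : ∀ {b} → Adj K (Φ ⟨$⟩ʳ v) (Φ ⟨$⟩ʳ punchIn v b) → Adj G v (punchIn v b)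
    reflect-v {b} Φv~Φb = subst (λ a → Adj G v (punchIn v a)) (sym (to-injective ψ to-b≡to-u)) (proj₁ G-pendant)
      where
      to-b≡to-u : to ψ b ≡ to ψ u
      to-b≡to-u = pendant-neighbour K w K-pendant (subst₂ (Adj K) (insert-self v w π) (Φ-punchIn b) Φv~Φb)

    preserve : ∀ x y → Adj G x y → Adj K (Φ ⟨$⟩ʳ x) (Φ ⟨$⟩ʳ y)
    preserve x y x~y with punchInView v x | punchInView v y
    ... | at        | at        = ⊥-elim (irrefl G x~y)
    ... | at        | punched b = preserve-v x~y
    ... | punched a | at        = symAdj K (preserve-v (symAdj G x~y))
    ... | punched a | punched b =
      subst₂ (Adj K) (sym (Φ-punchIn a)) (sym (Φ-punchIn b)) (_≅_.preserve ψ a b x~y)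

    reflect : ∀ x y → Adj K (Φ ⟨$⟩ʳ x) (Φ ⟨$⟩ʳ y) → Adj G x y
    reflect x y Φx~Φy with punchInView v x | punchInView v y
    ... | at        | at        = ⊥-elim (irrefl K Φx~Φy)
    ... | at        | punched b = reflect-v Φx~Φy
    ... | punched a | at        = symAdj G (reflect-v (symAdj K Φx~Φy))
    ... | punched a | punched b = _≅_.reflect ψ a b (subst₂ (Adj K) (Φ-punchIn a) (Φ-punchIn b) Φx~Φy)

  pendant-extension : G ≅ K
  pendant-extension = record { bij = Φ ; preserve = preserve ; reflect = reflect }

path-tail : path (suc (suc n)) - zero ≅ path (suc n)
path-tail = record
  { bij      = Perm.id
  ; preserve = λ _ _ → Data.Sum.map suc-injective suc-injective
  ; reflect  = λ _ _ → Data.Sum.map (cong suc) (cong suc)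
  }

path-head-pendant : Pendant (path (suc (suc n))) zero (suc zero)
path-head-pendant = inj₁ refl , λ
  { zero          (inj₁ ()) ; zero          (inj₂ ())
  ; (suc zero)    _         → refl
  ; (suc (suc _)) (inj₁ ()) ; (suc (suc _)) (inj₂ ()) }

suc-opposite : (x : Fin n) → suc (toℕ (opposite x)) ≡ n ∸ toℕ x
suc-opposite x = trans (cong suc (opposite-prop x)) (sym (+-∸-assoc 1 (toℕ<n x)))

opposite-adjacent : (x y : Fin n) → suc (toℕ (opposite x)) ≡ toℕ (opposite y) ⇔ suc (toℕ y) ≡ toℕ x
opposite-adjacent {n} x y = mk⇔
  (λ eq → sym (∸-cancelˡ-≡ (<⇒≤ (toℕ<n x)) (toℕ<n y) (trans (sym (suc-opposite x)) (trans eq (opposite-prop y)))))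
  (λ eq → trans (suc-opposite x) (trans (cong (n ∸_) (sym eq)) (sym (opposite-prop y))))

path-reverse : ∀ n → path n ≅ path n
path-reverse n = record { bij = reverse ; preserve = preserve ; reflect = reflect }
  where
  preserve : ∀ x y → PathAdj x y → PathAdj (opposite x) (opposite y)
  preserve x y (inj₁ eq) = inj₂ (Equivalence.from (opposite-adjacent y x) eq)
  preserve x y (inj₂ eq) = inj₁ (Equivalence.from (opposite-adjacent x y) eq)
  reflect : ∀ x y → PathAdj (opposite x) (opposite y) → PathAdj x y
  reflect x y (inj₁ eq) = inj₂ (Equivalence.to (opposite-adjacent x y) eq)
  reflect x y (inj₂ eq) = inj₁ (Equivalence.to (opposite-adjacent y x) eq)

module _ (G : Graph (suc (suc n))) (v : Fin (suc (suc n))) {u : Fin (suc n)} (pendant : Pendant G v (punchIn v u)) where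

  path-extension-head : (ψ : G - v ≅ path (suc n)) → to ψ u ≡ zero → G ≅ path (suc (suc n))
  path-extension-head ψ u↦0 = pendant-extension (≅-trans ψ (≅-sym path-tail)) pendant
    (subst (λ t → Pendant (path _) zero (suc t)) (sym u↦0) path-head-pendant)

  path-extension-last : (ψ : G - v ≅ path (suc n)) → to ψ u ≡ fromℕ n → G ≅ path (suc (suc n))
  path-extension-last ψ u↦last = path-extension-head (≅-trans ψ (path-reverse _))
    (trans (cong opposite u↦last) (opposite-involutive zero))

-- Splitting the convex sets of G at a vertex

module Deletion (G : Graph (suc (suc m))) (v : Fin (suc (suc m))) where

  restrict-convex : ∀ S b → P3Convex G (insertAt S v b) → P3Convex (G - v) S
  restrict-convex S b convex x z y x≢z z≢y x≢y x~z z~y x∈ y∈ = subst T (insertAt-punchIn S v b z)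
    (convex (punchIn v x) (punchIn v z) (punchIn v y)
            (x≢z ∘ punchIn-injective v x z) (z≢y ∘ punchIn-injective v z y) (x≢y ∘ punchIn-injective v x y)
            x~z z~y (subst T (sym (insertAt-punchIn S v b x)) x∈) (subst T (sym (insertAt-punchIn S v b y)) y∈))

  without-v? : Decidable (λ S → P3Convex G (insertAt S v false))
  without-v? S = P3Convex? G (insertAt S v false)

  with-v? : Decidable (λ S → P3Convex G (insertAt S v true))
  with-v? S = P3Convex? G (insertAt S v true)

  noc-split : noc G ≡ count without-v? + count with-v?
  noc-split = trans (count-insertAt (P3Convex? G) v) (+-comm (count with-v?) (count without-v?))

  count-without-v≤ : count without-v? ≤ noc (G - v)
  count-without-v≤ = count-mono without-v? (P3Convex? (G - v)) (restrict-convex _ false)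

  -- The vertex set of  G - v  is convex, but it is not convex in  G  once  v  has two neighbours.
  count-without-v< : ∀ {p q} → Adj G v p → Adj G v q → p ≢ q → count without-v? < noc (G - v)
  count-without-v< {p} {q} v~p v~q p≢q = begin
    suc (count without-v?)                           ≡⟨ +-comm 1 _ ⟩
    count without-v? + 1                             ≡⟨ cong (count without-v? +_) (count-singleton full) ⟨
    count without-v? + count (λ S → VSet-≟ S full)   ≤⟨ count-disjoint without-v? (λ S → VSet-≟ S full) (P3Convex? (G - v))
                                                          (restrict-convex _ false) (λ { refl → full-convex }) full-nonconvex ⟩
    noc (G - v)                                      ∎
    where
    open ≤-Reasoning
    full : VSet (suc m)
    full = replicate (suc m) true
    ∈full : ∀ x → x ∈ₛ full
    ∈full x = subst T (sym (lookup-replicate x true)) tt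
    full-convex : P3Convex (G - v) full
    full-convex _ z _ _ _ _ _ _ _ _ = ∈full z
    ∈full-v : ∀ {x} → v ≢ x → x ∈ₛ insertAt full v false
    ∈full-v v≢x = subst (_∈ₛ insertAt full v false) (punchIn-punchOut v≢x)
                        (subst T (sym (insertAt-punchIn full v false (punchOut v≢x))) (∈full (punchOut v≢x)))
    full-nonconvex : ∀ {S} → P3Convex G (insertAt S v false) → ¬ S ≡ full
    full-nonconvex convex refl = subst T (insertAt-lookup full v false)
      (convex p v q (Adj⇒≢ G (symAdj G v~p)) (Adj⇒≢ G v~q) p≢q (symAdj G v~p) v~q
              (∈full-v (Adj⇒≢ G v~p)) (∈full-v (Adj⇒≢ G v~q)))

  module _ (H-connected : Connected (G - v)) {u : Fin (suc m)} (v~u : Adj G v (punchIn v u)) where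
    open KeyInequality (G - v) H-connected u

    count-with-v≤ : count with-v? ≤ count convex∋u? + count convex-avoiding?
    count-with-v≤ = count-∪ convex∋u? convex-avoiding? with-v? restrict
      where
      restrict : ∀ {S} → P3Convex G (insertAt S v true) → (P3Convex (G - v) S × u ∈ₛ S) ⊎ (P3Convex (G - v) S × AvoidsN[u] S)
      restrict {S} convex with u ∈? S
      ... | yes u∈S = inj₁ (restrict-convex S true convex , u∈S)
      ... | no  u∉S = inj₂ (restrict-convex S true convex , u∉S , λ y u~y → u∉S ∘ v-u-y y u~y)
        where
        v-u-y : ∀ y → Adj (G - v) u y → y ∈ₛ S → u ∈ₛ S
        v-u-y y u~y y∈S = subst T (insertAt-punchIn S v true u)
          (convex v (punchIn v u) (punchIn v y) (Adj⇒≢ G v~u) (Adj⇒≢ G u~y) (punchInᵢ≢i v y ∘ sym) v~u u~y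
                  (subst T (sym (insertAt-lookup S v true)) tt) (subst T (sym (insertAt-punchIn S v true y)) y∈S))

-- Extremal graphs

module Others {n} (c u : Fin (suc (suc n))) (c≢u : c ≢ u) where

  other : Fin n → Fin (suc (suc n))
  other i = punchIn c (punchIn (punchOut c≢u) i)

  other≢c : ∀ i → other i ≢ c
  other≢c i = punchInᵢ≢i c _

  other≢u : ∀ i → other i ≢ u
  other≢u i eq = punchInᵢ≢i (punchOut c≢u) i (punchIn-injective c _ _ (trans eq (sym (punchIn-punchOut c≢u))))

  other-injective : ∀ {i j} → other i ≡ other j → i ≡ j
  other-injective = punchIn-injective (punchOut c≢u) _ _ ∘ punchIn-injective c _ _

-- In a star with at least three leaves, take all vertices but the centre: it breaks convexity at
-- the centre, and a leaf  u  has no neighbour in it.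
unmatched-star : (H : Graph (suc (suc (suc (suc n))))) → ∀ {c u} → StarCentre H c → u ≢ c → UnmatchedSet H u
unmatched-star {n} H {c} {u} (c~ , ≁) u≢c =
  unmatched Q (∈⟦⟧⁺ ≢c? u≢c) (Breach⇒nonconvex {H = H} {S = Q} β)
    (inj₂ ((c , symAdj H (c~ u u≢c)) , (λ y u~y y∈Q → ≁ u y u≢c (∈⟦⟧⁻ ≢c? y∈Q) u~y) , β , other≢u _ , other≢u _))
  where
  open Others c u (u≢c ∘ sym)
  ≢c? : Decidable (_≢ c)
  ≢c? x = ¬? (x ≟ c)
  Q : VSet (suc (suc (suc (suc n))))
  Q = ⟦ ≢c? ⟧
  β : Breach H Q
  β = breach (other zero) c (other (suc zero)) (other≢c _) (other≢c _ ∘ sym) (Fin.0≢1+n ∘ other-injective)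
             (symAdj H (c~ _ (other≢c _))) (c~ _ (other≢c _))
             (∈⟦⟧⁺ ≢c? (other≢c _)) (∈⟦⟧⁺ ≢c? (other≢c _)) (λ c∈Q → ∈⟦⟧⁻ ≢c? c∈Q refl)

unmatched-path4₁ : UnmatchedSet (path 4) (# 1)
unmatched-path4₁ = unmatched Q tt (toWitnessFalse {a? = P3Convex? (path 4) Q} tt)
  (inj₁ (# 0 , # 2 , inj₂ refl , tt , inj₁ refl , λ ()))
  where
  Q : VSet 4
  Q = true ∷ true ∷ false ∷ true ∷ []

unmatched-path4₂ : UnmatchedSet (path 4) (# 2)
unmatched-path4₂ = unmatched Q tt (toWitnessFalse {a? = P3Convex? (path 4) Q} tt)
  (inj₁ (# 3 , # 1 , inj₁ refl , tt , inj₂ refl , λ ()))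
  where
  Q : VSet 4
  Q = true ∷ false ∷ true ∷ true ∷ []

unmatched-path5 : ∀ t → UnmatchedSet (path 5) t
unmatched-path5 zero = unmatched Q tt (toWitnessFalse {a? = P3Convex? (path 5) Q} tt)
  (inj₂ ((# 1 , inj₁ refl) , toWitness {a? = all? λ y → adj? (path 5) (# 0) y →-dec ¬? (y ∈? Q)} tt ,
         breach (# 2) (# 3) (# 4) (λ ()) (λ ()) (λ ()) (inj₁ refl) (inj₁ refl) tt tt (λ ()) , (λ ()) , (λ ())))
  where
  Q : VSet 5
  Q = true ∷ false ∷ true ∷ false ∷ true ∷ []
unmatched-path5 (suc zero) = unmatched Q tt (toWitnessFalse {a? = P3Convex? (path 5) Q} tt)
  (inj₁ (# 0 , # 2 , inj₂ refl , tt , inj₁ refl , λ ()))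
  where
  Q : VSet 5
  Q = true ∷ true ∷ false ∷ true ∷ false ∷ []
unmatched-path5 (suc (suc zero)) = unmatched Q tt (toWitnessFalse {a? = P3Convex? (path 5) Q} tt)
  (inj₁ (# 1 , # 3 , inj₂ refl , tt , inj₁ refl , λ ()))
  where
  Q : VSet 5
  Q = false ∷ true ∷ true ∷ false ∷ true ∷ []
unmatched-path5 (suc (suc (suc zero))) = unmatched Q tt (toWitnessFalse {a? = P3Convex? (path 5) Q} tt)
  (inj₁ (# 4 , # 2 , inj₁ refl , tt , inj₂ refl , λ ()))
  where
  Q : VSet 5
  Q = false ∷ true ∷ false ∷ true ∷ true ∷ []
unmatched-path5 (suc (suc (suc (suc zero)))) = unmatched Q tt (toWitnessFalse {a? = P3Convex? (path 5) Q} tt)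
  (inj₂ ((# 3 , inj₂ refl) , toWitness {a? = all? λ y → adj? (path 5) (# 4) y →-dec ¬? (y ∈? Q)} tt ,
         breach (# 0) (# 1) (# 2) (λ ()) (λ ()) (λ ()) (inj₁ refl) (inj₁ refl) tt tt (λ ()) , (λ ()) , (λ ())))
  where
  Q : VSet 5
  Q = true ∷ false ∷ true ∷ false ∷ true ∷ []

-- Up to three vertices the extremal graphs are recorded as paths, so that they can be
-- extended at an end by  path-extension-head/last.
Extremal : Graph n → Set
Extremal {0} G = ⊥
Extremal {1} G = G ≅ path 1
Extremal {2} G = G ≅ path 2
Extremal {3} G = G ≅ path 3
Extremal {4} G = ∃ (StarCentre G) ⊎ G ≅ path 4
Extremal {5} G = ∃ (StarCentre G) ⊎ G ≅ path 5
Extremal {suc (suc (suc (suc (suc (suc _)))))} G = ∃ (StarCentre G)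

star-extension : ∀ {k} (G : Graph (suc (suc (suc (suc (suc k)))))) (v : Fin (suc (suc (suc (suc (suc k)))))) {u} →
  Pendant G v (punchIn v u) → ¬ UnmatchedSet (G - v) u → ∀ {c} → StarCentre (G - v) c → ∃ (StarCentre G)
star-extension G v {u} pendant no-unmatched {c} centre with u ≟ c
... | yes refl = punchIn v u , StarCentre-extend G v pendant centre
... | no  u≢c  = ⊥-elim (no-unmatched (unmatched-star (G - v) centre u≢c))

path3-centre : StarCentre (path 3) (# 1)
path3-centre = toWitness {a? = StarCentre? (path 3) (# 1)} tt

extremal-extension : ∀ {m} (G : Graph (suc (suc m))) (v : Fin (suc (suc m))) {u : Fin (suc m)} →
  Pendant G v (punchIn v u) → ¬ UnmatchedSet (G - v) u → Extremal (G - v) → Extremal G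
extremal-extension {0} G v {u} pendant _ ψ with to ψ u in u↦
... | zero = path-extension-head G v pendant ψ u↦
extremal-extension {1} G v {u} pendant _ ψ with to ψ u in u↦
... | zero     = path-extension-head G v pendant ψ u↦
... | suc zero = path-extension-last G v pendant ψ u↦
extremal-extension {2} G v {u} pendant _ ψ with to ψ u in u↦
... | zero           = inj₂ (path-extension-head G v pendant ψ u↦)
... | suc zero       = inj₁ (punchIn v u , StarCentre-extend G v pendant
                               (subst (StarCentre (G - v)) (from-to ψ u↦) (StarCentre-from ψ path3-centre)))
... | suc (suc zero) = inj₂ (path-extension-last G v pendant ψ u↦)
extremal-extension {3} G v pendant no-unmatched (inj₁ (_ , centre)) = inj₁ (star-extension G v pendant no-unmatched centre)
extremal-extension {3} G v {u} pendant no-unmatched (inj₂ ψ) with to ψ u in u↦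
... | zero                 = inj₂ (path-extension-head G v pendant ψ u↦)
... | suc zero             = ⊥-elim (no-unmatched (Transport.unmatched-pull ψ u
                               (subst (UnmatchedSet (path 4)) (sym u↦) unmatched-path4₁)))
... | suc (suc zero)       = ⊥-elim (no-unmatched (Transport.unmatched-pull ψ u
                               (subst (UnmatchedSet (path 4)) (sym u↦) unmatched-path4₂)))
... | suc (suc (suc zero)) = inj₂ (path-extension-last G v pendant ψ u↦)
extremal-extension {4} G v pendant no-unmatched (inj₁ (_ , centre)) = star-extension G v pendant no-unmatched centre
extremal-extension {4} G v {u} pendant no-unmatched (inj₂ ψ) =
  ⊥-elim (no-unmatched (Transport.unmatched-pull ψ u (unmatched-path5 (to ψ u))))
extremal-extension {suc (suc (suc (suc (suc _))))} G v pendant no-unmatched (_ , centre) =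
  star-extension G v pendant no-unmatched centre

Extremal⇒ : (G : Graph n) → Extremal G → G ≅ star n ⊎ G ≅ path 4 ⊎ G ≅ path 5
Extremal⇒ {1} G ψ = inj₁ (StarCentre⇒≅star G (StarCentre-from ψ (toWitness {a? = StarCentre? (path 1) zero} tt)))
Extremal⇒ {2} G ψ = inj₁ (StarCentre⇒≅star G (StarCentre-from ψ (toWitness {a? = StarCentre? (path 2) zero} tt)))
Extremal⇒ {3} G ψ = inj₁ (StarCentre⇒≅star G (StarCentre-from ψ path3-centre))
Extremal⇒ {4} G (inj₁ (_ , centre)) = inj₁ (StarCentre⇒≅star G centre)
Extremal⇒ {4} G (inj₂ ψ) = inj₂ (inj₁ ψ)
Extremal⇒ {5} G (inj₁ (_ , centre)) = inj₁ (StarCentre⇒≅star G centre)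
Extremal⇒ {5} G (inj₂ ψ) = inj₂ (inj₂ ψ)
Extremal⇒ {suc (suc (suc (suc (suc (suc _)))))} G (_ , centre) = inj₁ (StarCentre⇒≅star G centre)

AtMostOne : VSet n → Set
AtMostOne {n} S = ∀ (i j : Fin n) → i ∈ₛ S → j ∈ₛ S → i ≡ j

atMostOne? : Decidable (AtMostOne {n})
atMostOne? S = all? λ i → all? λ j → i ∈? S →-dec j ∈? S →-dec i ≟ j

count-atMostOne : ∀ n → count (atMostOne? {n}) ≡ suc n
count-atMostOne zero    = count-all (atMostOne? {0}) λ _ ()
count-atMostOne (suc n) = begin
  count (atMostOne? {suc n})
    ≡⟨ count-∷ (atMostOne? {suc n}) ⟩
  count (atMostOne? {suc n} ∘ (true ∷_)) + count (atMostOne? {suc n} ∘ (false ∷_))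
    ≡⟨ cong₂ _+_ (trans (count-cong (atMostOne? {suc n} ∘ (true ∷_)) (λ S → VSet-≟ S (∅ {n}))
                                    (λ {S} → only-head {S}) (λ {S} → only-head⁻ {S}))
                        (count-singleton (∅ {n})))
                 (trans (count-cong (atMostOne? {suc n} ∘ (false ∷_)) (atMostOne? {n}) (λ {S} → tail {S}) (λ {S} → tail⁻ {S}))
                        (count-atMostOne n)) ⟩
  1 + suc n ∎
  where
  open ≡-Reasoning
  only-head : ∀ {S} → AtMostOne (true ∷ S) → S ≡ ∅
  only-head amo = ¬Nonempty⇒≡∅ λ (i , i∈S) → Fin.0≢1+n (amo zero (suc i) tt i∈S)
  only-head⁻ : ∀ {S} → S ≡ ∅ → AtMostOne (true ∷ S)
  only-head⁻ refl zero    zero    _  _  = refl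
  only-head⁻ refl zero    (suc j) _  j∈ = ⊥-elim (∉∅ {x = j} j∈)
  only-head⁻ refl (suc i) _       i∈ _  = ⊥-elim (∉∅ {x = i} i∈)
  tail : ∀ {S} → AtMostOne (false ∷ S) → AtMostOne S
  tail amo i j i∈ j∈ = Fin.suc-injective (amo (suc i) (suc j) i∈ j∈)
  tail⁻ : ∀ {S} → AtMostOne S → AtMostOne (false ∷ S)
  tail⁻ amo (suc i) (suc j) i∈ j∈ = cong suc (amo i j i∈ j∈)

-- A convex set of the star either contains the centre (and then it is arbitrary) or is a
-- set of at most one leaf.
noc-star : ∀ m → noc (star (suc m)) ≡ 2 ^ m + suc m
noc-star m = begin
  noc (star (suc m))
    ≡⟨ count-∷ (P3Convex? (star (suc m))) ⟩
  count (λ S → P3Convex? (star (suc m)) (true ∷ S)) + count (λ S → P3Convex? (star (suc m)) (false ∷ S))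
    ≡⟨ cong₂ _+_ (count-all (λ S → P3Convex? (star (suc m)) (true ∷ S)) centre-convex)
                 (trans (count-cong (λ S → P3Convex? (star (suc m)) (false ∷ S)) (atMostOne? {m})
                                    (λ {S} → leaves-atMostOne {S}) (λ {S} → leaves-atMostOne⁻ {S}))
                        (count-atMostOne m)) ⟩
  2 ^ m + suc m ∎
  where
  open ≡-Reasoning
  leaf-neighbour : ∀ {k} {a : Fin (suc k)} {z} → StarAdj a (suc z) → a ≡ zero
  leaf-neighbour {a = zero}  _                = refl
  leaf-neighbour {a = suc _} (inj₁ (() , _))
  leaf-neighbour {a = suc _} (inj₂ (_ , ()))
  centre-convex : ∀ S → P3Convex (star (suc m)) (true ∷ S)
  centre-convex S a zero    b _ _ _   _   _   _ _ = tt
  centre-convex S a (suc z) b _ _ a≢b a~z z~b _ _ =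
    ⊥-elim (a≢b (trans (leaf-neighbour a~z) (sym (leaf-neighbour (symAdj (star (suc m)) z~b)))))
  leaves-atMostOne : ∀ {S} → P3Convex (star (suc m)) (false ∷ S) → AtMostOne S
  leaves-atMostOne convex i j i∈ j∈ with i ≟ j
  ... | yes i≡j = i≡j
  ... | no  i≢j = ⊥-elim (convex (suc i) zero (suc j) (λ ()) (λ ()) (i≢j ∘ Fin.suc-injective)
                                 (inj₂ ((λ ()) , refl)) (inj₁ (refl , λ ())) i∈ j∈)
  leaves-atMostOne⁻ : ∀ {S} → AtMostOne S → P3Convex (star (suc m)) (false ∷ S)
  leaves-atMostOne⁻ amo zero    _ _       _ _ _   _ _ () _
  leaves-atMostOne⁻ amo (suc i) _ zero    _ _ _   _ _ _  ()
  leaves-atMostOne⁻ amo (suc i) _ (suc j) _ _ a≢b _ _ i∈ j∈ = ⊥-elim (a≢b (cong suc (amo i j i∈ j∈)))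

noc-path4 : noc (path 4) ≡ 2 ^ 3 + 4
noc-path4 = refl

noc-path5 : noc (path 5) ≡ 2 ^ 4 + 5
noc-path5 = refl

sum-tight : ∀ {a b A B} → a ≤ A → b ≤ B → a + b ≡ A + B → a ≡ A × b ≡ B
sum-tight {a} {b} {A} {B} a≤A b≤B eq =
  ≤-antisym a≤A (+-cancelʳ-≤ B A a (≤-trans (≤-reflexive (sym eq)) (+-monoʳ-≤ a b≤B))) ,
  ≤-antisym b≤B (+-cancelˡ-≤ A B b (≤-trans (≤-reflexive (sym eq)) (+-monoˡ-≤ b a≤A)))

NocBound : Graph (suc m) → Set
NocBound {m} G = noc G ≤ 2 ^ m + suc m × (noc G ≡ 2 ^ m + suc m → Extremal G)

module DeletionStep (G : Graph (suc (suc m))) (connected : Connected G)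
                    (v : Fin (suc (suc m))) (H-connected : Connected (G - v)) (IH : NocBound (G - v)) where
  open Deletion G v

  private
    neighbour : ∃ (Adj G v)
    neighbour = Reach⇒neighbour (connected v (punchIn v zero)) (punchInᵢ≢i v zero ∘ sym)
    u : Fin (suc m)
    u = punchOut (Adj⇒≢ G (proj₂ neighbour))

    v~u : Adj G v (punchIn v u)
    v~u = subst (Adj G v) (sym (punchIn-punchOut _)) (proj₂ neighbour)

  open KeyInequality (G - v) H-connected u

  count-with-v-bound : count with-v? ≤ suc (2 ^ m)
  count-with-v-bound = ≤-trans (count-with-v≤ H-connected v~u) key

  bound-step : (2 ^ m + suc m) + suc (2 ^ m) ≡ 2 ^ suc m + suc (suc m)
  bound-step = lemma (2 ^ m) m
    where
    lemma : ∀ p m → (p + suc m) + suc p ≡ 2 * p + suc (suc m)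
    lemma = solve-∀

  noc-bound-step : NocBound G
  noc-bound-step = noc-≤ , extremal
    where
    open ≤-Reasoning
    noc-≤ : noc G ≤ 2 ^ suc m + suc (suc m)
    noc-≤ = begin
      noc G                                  ≡⟨ noc-split ⟩
      count without-v? + count with-v?       ≤⟨ +-mono-≤ (≤-trans count-without-v≤ (proj₁ IH)) count-with-v-bound ⟩
      (2 ^ m + suc m) + suc (2 ^ m)          ≡⟨ bound-step ⟩
      2 ^ suc m + suc (suc m)                ∎
    extremal : noc G ≡ 2 ^ suc m + suc (suc m) → Extremal G
    extremal noc≡ = extremal-extension G v pendant no-unmatched (proj₂ IH noc-H≡)
      where
      parts : count without-v? ≡ 2 ^ m + suc m × count with-v? ≡ suc (2 ^ m)
      parts = sum-tight (≤-trans count-without-v≤ (proj₁ IH)) count-with-v-bound (trans (sym noc-split) (trans noc≡ (sym bound-step)))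
      noc-H≡ : noc (G - v) ≡ 2 ^ m + suc m
      noc-H≡ = ≤-antisym (proj₁ IH) (subst (_≤ noc (G - v)) (proj₁ parts) count-without-v≤)
      pendant : Pendant G v (punchIn v u)
      pendant = v~u , λ y v~y → case y (y ≟ punchIn v u) v~y
        where
        case : ∀ y → Dec (y ≡ punchIn v u) → Adj G v y → y ≡ punchIn v u
        case y (yes y≡u) _   = y≡u
        case y (no  y≢u) v~y = ⊥-elim (<-irrefl (proj₁ parts) (<-≤-trans (count-without-v< v~y v~u y≢u) (proj₁ IH)))
      no-unmatched : ¬ UnmatchedSet (G - v) u
      no-unmatched W = 1+n≰n (subst (_≤ 2 ^ m) (proj₂ parts) (≤-trans (count-with-v≤ H-connected v~u) (key-strict W)))

noc-bound : ∀ m (G : Graph (suc m)) → Connected G → NocBound G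
noc-bound zero G _ = ≤-reflexive (count-all (P3Convex? G) λ S → single-vertex-convex {S}) , λ _ → single-vertex-path
  where
  single-vertex-convex : ∀ {S} → P3Convex G S
  single-vertex-convex zero zero _ zero≢zero = ⊥-elim (zero≢zero refl)
  single-vertex-path : G ≅ path 1
  single-vertex-path = record
    { bij = Perm.id
    ; preserve = λ { zero zero 0~0 → ⊥-elim (irrefl G 0~0) }
    ; reflect  = λ { zero zero (inj₁ ()) ; zero zero (inj₂ ()) }
    }
noc-bound (suc m) G connected with non-separating-vertex G connected
... | v , H-connected = DeletionStep.noc-bound-step G connected v H-connected (noc-bound m (G - v) H-connected)

theorem2p13 : (n : ℕ) → 1 ≤ n → (G : Graph n) → Connected G →
    (noc G ≤ 2 ^ (n ∸ 1) + n)
    × ((noc G ≡ 2 ^ (n ∸ 1) + n) ⇔ (G ≅ star n ⊎ G ≅ path 4 ⊎ G ≅ path 5))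
theorem2p13 (suc m) _ G connected =
  proj₁ (noc-bound m G connected) , mk⇔ (Extremal⇒ G ∘ proj₂ (noc-bound m G connected)) noc-extremal
  where
  noc-extremal : G ≅ star (suc m) ⊎ G ≅ path 4 ⊎ G ≅ path 5 → noc G ≡ 2 ^ m + suc m
  noc-extremal (inj₁ ψ) = trans (noc-≅ ψ) (noc-star m)
  noc-extremal (inj₂ (inj₁ ψ)) with refl ← ↔⇒≡ (_≅_.bij ψ) = trans (noc-≅ ψ) noc-path4
  noc-extremal (inj₂ (inj₂ ψ)) with refl ← ↔⇒≡ (_≅_.bij ψ) = trans (noc-≅ ψ) noc-path5
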